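{- For every field $\mathbb F$, the graph parameter $\operatorname{pm}$ is not expressible as a graph homomorphism function over $\mathbb F$; that is, there is no $\mathbb F$-weighted graph $H$ such that $\operatorname{pm}(G)=\hom(G,H)$ for every graph $G$.
   Context: Graphs $G$ are finite, may have multiple edges but no loops. $\operatorname{pm}(G)=m\cdot 1\in\mathbb F$ (the sum of $m$ copies of $1$), where $m$ is the number of perfect matchings of $G$ (the empty graph has one perfect matching). An $\mathbb F$-weighted graph $H$ is given by $q=|V(H)|\ge0$, vertex weights $\alpha_1,\dots,\alpha_q\in\mathbb F\setminus\{0\}$ and a symmetric matrix $B=(\beta_{ij})\in\mathbb F^{q\times q}$; $\hom(G,H)=\sum_{\phi:V(G)\to[q]}\prod_{u\in V(G)}\alpha_{\phi(u)}\prod_{uv\in E(G)}\beta_{\phi(u)\phi(v)}$ (edges with multiplicity; empty products equal $1$). -}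

module Defs where

open import Level using (Level; _⊔_; suc)
open import Data.Nat using (ℕ; zero) renaming (suc to sucℕ)
open import Data.Fin using (Fin; _≟_)
open import Data.Bool using (Bool; true; false; if_then_else_)
open import Data.List using (List; []; _∷_; map; concatMap; foldr; length; filter)
open import Data.Vec using (Vec; []; _∷_; lookup; allFin)
open import Data.Product using (_×_; _,_; proj₁; proj₂; Σ)
open import Relation.Nullary using (¬_; does)
open import Relation.Binary.PropositionalEquality using (_≡_)
open import Algebra.Bundles using (CommutativeRing)
open import Data.List.Membership.Propositional using (_∈_)
import Data.Bool.ListAction

record Field (c ℓ : Level) : Set (Level.suc (c ⊔ ℓ)) where
  field
    commutativeRing : CommutativeRing c ℓ
  open CommutativeRing commutativeRing public
  field
    0≉1     : ¬ (0# ≈ 1#)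
    inverse : ∀ x → ¬ (x ≈ 0#) → Σ Carrier (λ y → x * y ≈ 1#)

-- Finite multigraphs without loops.
-- Vertex set Fin n; edges are a list of ordered pairs (endpoint order
-- irrelevant), repetitions = parallel edges; no loops.

record Graph : Set where
  field
    n       : ℕ
    edges   : List (Fin n × Fin n)
    noLoops : ∀ {e} → e ∈ edges → ¬ (proj₁ e ≡ proj₂ e)

open Graph public

-- all sub-multisets of a list, chosen by position (2^m of them)
subLists : {A : Set} → List A → List (List A)
subLists []       = [] ∷ []
subLists (x ∷ xs) = let r = subLists xs in map (x ∷_) r Data.List.++ r

degreeIn : {n : ℕ} → Fin n → List (Fin n × Fin n) → ℕ
degreeIn v []             = zero
degreeIn v ((a , b) ∷ es) =
  if does (v ≟ a) Data.Bool.∨ does (v ≟ b) then sucℕ (degreeIn v es) else degreeIn v es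

isOne : ℕ → Bool
isOne (sucℕ zero) = true
isOne _           = false

isPerfectMatching : {n : ℕ} → List (Fin n × Fin n) → Bool
isPerfectMatching {n} S = Data.Bool.ListAction.and (map (λ v → isOne (degreeIn v S)) (Data.Vec.toList (allFin n)))

countTrue : List Bool → ℕ
countTrue []            = zero
countTrue (true ∷ bs)   = sucℕ (countTrue bs)
countTrue (false ∷ bs)  = countTrue bs

#pm : Graph → ℕ
#pm G = countTrue (map isPerfectMatching (subLists (edges G)))

module _ {c ℓ : Level} (F : Field c ℓ) where
  open Field F

  ℕ→F : ℕ → Carrier
  ℕ→F zero     = 0#
  ℕ→F (sucℕ m) = 1# + ℕ→F m

  pm : Graph → Carrier
  pm G = ℕ→F (#pm G)

  record WeightedGraph : Set (c ⊔ ℓ) where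
    field
      q        : ℕ
      α        : Fin q → Carrier
      β        : Fin q → Fin q → Carrier
      α≉0      : ∀ i → ¬ (α i ≈ 0#)
      β-sym    : ∀ i j → β i j ≈ β j i

  allMaps : (n q : ℕ) → List (Vec (Fin q) n)
  allMaps zero     q = [] ∷ []
  allMaps (sucℕ n) q =
    concatMap (λ φ → map (_∷ φ) (Data.Vec.toList (allFin q))) (allMaps n q)

  sumF : List Carrier → Carrier
  sumF = foldr _+_ 0#

  prodF : List Carrier → Carrier
  prodF = foldr _*_ 1#

  hom : Graph → WeightedGraph → Carrier
  hom G H = sumF (map term (allMaps (n G) q))
    where
      open WeightedGraph H
      term : Vec (Fin q) (n G) → Carrier
      term φ = prodF (map (λ u → α (lookup φ u)) (Data.Vec.toList (allFin (n G))))
             * prodF (map (λ e → β (lookup φ (proj₁ e)) (lookup φ (proj₂ e))) (edges G))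

module Submission where

-- Test against stars.  Let Star k have leaves 0 … k−1 joined to a centre k.  It has
-- one perfect matching for k = 1 and none for k ≥ 2 (two leaves would compete for the
-- centre).  On the other hand, for an F-weighted graph H with vertex weights α and
-- edge weights β, summing over the image c of the centre, every leaf contributes
-- independently the factor  d c = Σ_j α j · β j c,  so that
--     hom (Star k) H  =  Σ_c α c · (d c)^k.
-- Hence pm = hom (·, H) would give power sums with Σ_c α c · d c = 1 and
-- Σ_c α c · (d c)^k = 0 for every k ≥ 2.  This is impossible in a field: if all power
-- sums of order ≥ 2 vanish then so does the first one.  By induction on the number of
-- nodes: for a node x₀ with d x₀ ≠ 0, replacing the weights u by (d − d x₀)·u removes
-- x₀ and turns power sums of order m+1 into combinations of those of order m+1 and
-- m+2; a node with d x₀ = 0 contributes nothing to any power sum of positive order.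
-- The case distinction "d x₀ = 0 or not" is classical, so that lemma is proved in
-- double-negated form, which suffices to derive a contradiction.

open import Defs
open import Level using (Level)
open import Algebra.Bundles using (Semiring)
import Algebra.Definitions.RawSemiring as RawSemiringDefinitions
import Algebra.Properties.CommutativeSemigroup as CommutativeSemigroupProperties
open import Data.Product using (Σ; _,_; proj₁; proj₂; _×_)
open import Data.Nat using (ℕ; zero; suc)
open import Data.Fin using (Fin; fromℕ; _≟_) renaming (zero to f0; suc to fs)
open import Data.Fin.Properties using (suc-injective)
open import Data.Bool using (Bool; false)
open import Data.Bool.Properties using (∧-zeroʳ)
open import Data.Bool.ListAction using (and)
open import Data.List using (List; []; _∷_; map; _++_; concatMap; foldr)
open import Data.List.Properties using (map-∘; map-++; ++-identityʳ)
open import Data.List.Membership.Propositional using (_∈_)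
open import Data.List.Relation.Unary.Any using (here; there)
open import Data.List.Relation.Unary.All as All using (All; []; _∷_)
import Data.List.Relation.Unary.All.Properties as All
open import Data.Vec using (Vec; []; _∷_; lookup; allFin; tabulate; toList)
open import Data.Vec.Properties using (toList-map; tabulate-∘)
open import Data.Vec.Membership.Propositional.Properties using (∈-allFin⁺; ∈-toList⁺)
open import Function using (_∘_)
open import Relation.Nullary using (¬_; yes; no; contradiction)
open import Relation.Nullary.Decidable using (¬¬-excluded-middle)
open import Relation.Binary.PropositionalEquality as ≡ using (_≡_)

module FiniteSums {c ℓ : Level} (R : Semiring c ℓ) where
  open Semiring R

  sum : List Carrier → Carrier
  sum = foldr _+_ 0#

  sum-++ : (xs ys : List Carrier) → sum (xs ++ ys) ≈ sum xs + sum ys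
  sum-++ []       ys = sym (+-identityˡ _)
  sum-++ (x ∷ xs) ys = trans (+-congˡ (sum-++ xs ys)) (sym (+-assoc _ _ _))

  sum-cong : {X : Set} {f g : X → Carrier} (xs : List X) →
             (∀ x → f x ≈ g x) → sum (map f xs) ≈ sum (map g xs)
  sum-cong []       f≈g = refl
  sum-cong (x ∷ xs) f≈g = +-cong (f≈g x) (sum-cong xs f≈g)

  sum-concatMap : {X Y : Set} (f : Y → Carrier) (block : X → List Y) (xs : List X) →
    sum (map f (concatMap block xs)) ≈ sum (map (λ x → sum (map f (block x))) xs)
  sum-concatMap f block []       = refl
  sum-concatMap f block (x ∷ xs) =
    trans (reflexive (≡.cong sum (map-++ f (block x) (concatMap block xs))))
          (trans (sum-++ (map f (block x)) _) (+-congˡ (sum-concatMap f block xs)))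

  sum-*ˡ : {X : Set} (a : Carrier) (f : X → Carrier) (xs : List X) →
           a * sum (map f xs) ≈ sum (map (λ x → a * f x) xs)
  sum-*ˡ a f []       = zeroʳ a
  sum-*ˡ a f (x ∷ xs) = trans (distribˡ a _ _) (+-congˡ (sum-*ˡ a f xs))

-- Star k: vertex set Fin (k+1), leaves 0 … k−1, centre k.  Star (k+1) arises from
-- Star k by shifting all vertices up by one and attaching the new leaf 0.
shift : {n : ℕ} → Fin n × Fin n → Fin (suc n) × Fin (suc n)
shift (a , b) = fs a , fs b

starEdges : (k : ℕ) → List (Fin (suc k) × Fin (suc k))
starEdges zero    = []
starEdges (suc k) = (f0 , fromℕ (suc k)) ∷ map shift (starEdges k)

starEdges-loopless : ∀ k → All (λ e → ¬ (proj₁ e ≡ proj₂ e)) (starEdges k)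
starEdges-loopless zero    = []
starEdges-loopless (suc k) =
  (λ ()) ∷ All.map⁺ (All.map (λ a≢b → a≢b ∘ suc-injective) (starEdges-loopless k))

Star : ℕ → Graph
Star k = record { n = suc k ; edges = starEdges k ; noLoops = All.lookup (starEdges-loopless k) }

and-map-false : {X : Set} (p : X → Bool) {x : X} {xs : List X} →
                x ∈ xs → p x ≡ false → and (map p xs) ≡ false
and-map-false p (here ≡.refl) px≡false rewrite px≡false = ≡.refl
and-map-false p {xs = y ∷ _} (there x∈xs) px≡false
  rewrite and-map-false p x∈xs px≡false = ∧-zeroʳ (p y)

not-perfect : {n : ℕ} (S : List (Fin n × Fin n)) (v : Fin n) →
              isOne (degreeIn v S) ≡ false → isPerfectMatching S ≡ false
not-perfect S v = and-map-false (λ w → isOne (degreeIn w S)) (∈-toList⁺ (∈-allFin⁺ v))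

degree-shift-new : {n : ℕ} (S : List (Fin n × Fin n)) → degreeIn f0 (map shift S) ≡ 0
degree-shift-new []      = ≡.refl
degree-shift-new (_ ∷ S) = degree-shift-new S

degree-shift-old : {n : ℕ} (v : Fin n) (S : List (Fin n × Fin n)) →
                   degreeIn (fs v) (map shift S) ≡ degreeIn v S
degree-shift-old v []      = ≡.refl
degree-shift-old v (_ ∷ S) rewrite degree-shift-old v S = ≡.refl

degree-cons-end : {n : ℕ} (a v : Fin n) (S : List (Fin n × Fin n)) →
                  degreeIn v ((a , v) ∷ S) ≡ suc (degreeIn v S)
degree-cons-end a v S with v ≟ a | v ≟ v
... | yes _ | _      = ≡.refl
... | no _  | yes _  = ≡.refl
... | no _  | no v≢v = contradiction ≡.refl v≢v

subLists-map : {A B : Set} (f : A → B) (xs : List A) →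
               subLists (map f xs) ≡ map (map f) (subLists xs)
subLists-map f []       = ≡.refl
subLists-map f (x ∷ xs) rewrite subLists-map f xs = ≡.sym (begin
    map (map f) (map (x ∷_) r ++ r)          ≡⟨ map-++ (map f) (map (x ∷_) r) r ⟩
    map (map f) (map (x ∷_) r) ++ map (map f) r
      ≡⟨ ≡.cong (_++ map (map f) r) (≡.trans (≡.sym (map-∘ r)) (map-∘ r)) ⟩
    map (f x ∷_) (map (map f) r) ++ map (map f) r ∎)
  where
    open ≡.≡-Reasoning
    r = subLists xs

relabel-subLists : {A B : Set} (f : A → B) {Q : List B → Set} {L : List A} →
                   All (Q ∘ map f) (subLists L) → All Q (subLists (map f L))
relabel-subLists f {L = L} Q-relabelled rewrite subLists-map f L = All.map⁺ Q-relabelled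

count-none : {n : ℕ} (Ss : List (List (Fin n × Fin n))) →
             All (λ S → isPerfectMatching S ≡ false) Ss →
             countTrue (map isPerfectMatching Ss) ≡ 0
count-none []       []         = ≡.refl
count-none (S ∷ Ss) (S-fails ∷ Ss-fail) rewrite S-fails = count-none Ss Ss-fail

#pm-Star1 : #pm (Star 1) ≡ 1
#pm-Star1 = ≡.refl

-- Its edges are e₀ = (0, c), e₁ = (1, c) and
-- doubly shifted ones; if e₀, e₁ are both chosen the centre c is covered twice,
-- otherwise leaf 0 or leaf 1 is uncovered.
#pm-Star : ∀ k → #pm (Star (suc (suc k))) ≡ 0
#pm-Star k = count-none _
  (All.++⁺ (All.map⁺ (All.++⁺ (All.map⁺ (shifted both)) (shifted only-e₀)))
           (All.++⁺ (All.map⁺ (shifted only-e₁)) (shifted neither)))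
  where
    Edge  = Fin (suc (suc (suc k))) × Fin (suc (suc (suc k)))
    Inner = List (Fin (suc k) × Fin (suc k))

    lift : Inner → List Edge
    lift S = map shift (map shift S)

    c : Fin (suc (suc (suc k)))
    c = fs (fs (fromℕ k))

    shifted : {Q : List Edge → Set} → (∀ S → Q (lift S)) →
              All Q (subLists (lift (starEdges k)))
    shifted q = relabel-subLists shift {L = map shift (starEdges k)}
                  (relabel-subLists shift {L = starEdges k} (All.universal q _))

    leaf₀-free : ∀ (S : Inner) → isOne (degreeIn f0 (lift S)) ≡ false
    leaf₀-free S = ≡.cong isOne (degree-shift-new (map shift S))

    leaf₁-free : ∀ (S : Inner) → isOne (degreeIn (fs f0) (lift S)) ≡ false
    leaf₁-free S =
      ≡.cong isOne (≡.trans (degree-shift-old f0 (map shift S)) (degree-shift-new S))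

    both : ∀ (S : Inner) → isPerfectMatching ((f0 , c) ∷ (fs f0 , c) ∷ lift S) ≡ false
    both S = not-perfect ((f0 , c) ∷ (fs f0 , c) ∷ lift S) c (≡.cong isOne centre-twice)
      where
        centre-twice : degreeIn c ((f0 , c) ∷ (fs f0 , c) ∷ lift S)
                     ≡ suc (suc (degreeIn c (lift S)))
        centre-twice = ≡.trans (degree-cons-end f0 c ((fs f0 , c) ∷ lift S))
                               (≡.cong suc (degree-cons-end (fs f0) c (lift S)))

    only-e₀ : ∀ (S : Inner) → isPerfectMatching ((f0 , c) ∷ lift S) ≡ false
    only-e₀ S = not-perfect ((f0 , c) ∷ lift S) (fs f0) (leaf₁-free S)

    only-e₁ : ∀ (S : Inner) → isPerfectMatching ((fs f0 , c) ∷ lift S) ≡ false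
    only-e₁ S = not-perfect ((fs f0 , c) ∷ lift S) f0 (leaf₀-free S)

    neither : ∀ (S : Inner) → isPerfectMatching (lift S) ≡ false
    neither S = not-perfect (lift S) f0 (leaf₀-free S)

map-toList-tabulate : {n : ℕ} {a b : Level} {A : Set a} {B : Set b}
                      (f : A → B) (g : Fin n → A) →
                      map f (toList (tabulate g)) ≡ toList (tabulate (f ∘ g))
map-toList-tabulate f g =
  ≡.trans (≡.sym (toList-map f (tabulate g))) (≡.cong toList (≡.sym (tabulate-∘ f g)))

module StarHom {c ℓ : Level} (F : Field c ℓ) (H : WeightedGraph F) where
  open Field F hiding (zero)
  open WeightedGraph H
  open FiniteSums semiring
  open RawSemiringDefinitions (Semiring.rawSemiring semiring) using (_^_)
  open CommutativeSemigroupProperties *-commutativeSemigroup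
    using (interchange; x∙yz≈y∙xz; x∙yz≈xz∙y; xy∙z≈xz∙y)

  vertices : List (Fin q)
  vertices = toList (allFin q)

  -- weighted number of ways to map a leaf next to a centre mapped to c
  d : Fin q → Carrier
  d c = sum (map (λ j → α j * β j c) vertices)

  starTerm : ∀ k → Vec (Fin q) (suc k) → Carrier
  starTerm k φ = prodF F (map (λ u → α (lookup φ u)) (toList (allFin (suc k))))
               * prodF F (map (λ e → β (lookup φ (proj₁ e)) (lookup φ (proj₂ e)))
                              (starEdges k))

  starTerm-step : ∀ k (j : Fin q) (φ : Vec (Fin q) (suc k)) →
    starTerm (suc k) (j ∷ φ) ≈ (α j * β j (lookup φ (fromℕ k))) * starTerm k φ
  starTerm-step k j φ =
    trans (*-cong (*-congˡ (reflexive old-vertices)) (*-congˡ (reflexive old-edges)))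
          (interchange _ _ _ _)
    where
      old-vertices : prodF F (map (λ u → α (lookup (j ∷ φ) u)) (toList (tabulate fs)))
                   ≡ prodF F (map (λ u → α (lookup φ u)) (toList (allFin (suc k))))
      old-vertices = ≡.cong (prodF F)
        (≡.trans (map-toList-tabulate (λ u → α (lookup (j ∷ φ) u)) fs)
                 (≡.sym (map-toList-tabulate (λ u → α (lookup φ u)) (λ u → u))))
      old-edges : prodF F (map (λ e → β (lookup (j ∷ φ) (proj₁ e)) (lookup (j ∷ φ) (proj₂ e)))
                               (map shift (starEdges k)))
                ≡ prodF F (map (λ e → β (lookup φ (proj₁ e)) (lookup φ (proj₂ e)))
                               (starEdges k))
      old-edges = ≡.cong (prodF F) (≡.sym (map-∘ (starEdges k)))

  star-sum : ∀ k (g : Fin q → Carrier) →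
    sum (map (λ φ → g (lookup φ (fromℕ k)) * starTerm k φ) (allMaps F (suc k) q))
      ≈ sum (map (λ c → g c * (α c * d c ^ k)) vertices)
  star-sum zero g =
    trans (reflexive (≡.cong (sum ∘ map (λ φ → g (lookup φ f0) * starTerm zero φ))
                             (++-identityʳ (map (_∷ []) vertices))))
          (trans (reflexive (≡.cong sum (≡.sym (map-∘ vertices))))
                 (sum-cong vertices (λ c → *-congˡ (*-identityʳ (α c * 1#)))))
  star-sum (suc k) g = begin
      sum (map (λ φ → g (lookup φ (fromℕ (suc k))) * starTerm (suc k) φ)
               (allMaps F (suc (suc k)) q))
    ≈⟨ sum-concatMap _ (λ φ → map (_∷ φ) vertices) (allMaps F (suc k) q) ⟩
      sum (map (λ φ → sum (map (λ ψ → g (lookup ψ (fromℕ (suc k))) * starTerm (suc k) ψ)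
                               (map (_∷ φ) vertices)))
               (allMaps F (suc k) q))
    ≈⟨ sum-cong (allMaps F (suc k) q) new-leaf ⟩
      sum (map (λ φ → (g (lookup φ (fromℕ k)) * d (lookup φ (fromℕ k))) * starTerm k φ)
               (allMaps F (suc k) q))
    ≈⟨ star-sum k (λ c → g c * d c) ⟩
      sum (map (λ c → (g c * d c) * (α c * d c ^ k)) vertices)
    ≈⟨ sum-cong vertices (λ c → trans (*-assoc _ _ _) (*-congˡ (x∙yz≈y∙xz _ _ _))) ⟩
      sum (map (λ c → g c * (α c * d c ^ suc k)) vertices) ∎
    where
      open import Relation.Binary.Reasoning.Setoid setoid
      new-leaf : ∀ φ →
        sum (map (λ ψ → g (lookup ψ (fromℕ (suc k))) * starTerm (suc k) ψ) (map (_∷ φ) vertices))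
                       ≈ (g (lookup φ (fromℕ k)) * d (lookup φ (fromℕ k))) * starTerm k φ
      new-leaf φ =
        trans (reflexive (≡.cong sum (≡.sym (map-∘ vertices))))
         (trans (sum-cong vertices λ j →
                   trans (*-congˡ (starTerm-step k j φ)) (x∙yz≈xz∙y _ _ _))
          (trans (sym (sum-*ˡ _ _ vertices)) (xy∙z≈xz∙y _ _ _)))

  hom-Star : ∀ k → hom F (Star k) H ≈ sum (map (λ c → α c * d c ^ k) vertices)
  hom-Star k =
    trans (sum-cong (allMaps F (suc k) q) (λ φ → sym (*-identityˡ (starTerm k φ))))
          (trans (star-sum k (λ _ → 1#)) (sum-cong vertices (λ c → *-identityˡ _)))

module PowerSums {c ℓ : Level} (F : Field c ℓ) {X : Set} (d : X → Field.Carrier F) where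
  open Field F hiding (zero)
  open FiniteSums semiring
  open RawSemiringDefinitions (Semiring.rawSemiring semiring) using (_^_)
  open import Relation.Binary.Reasoning.Setoid setoid

  powerSum : List X → (X → Carrier) → ℕ → Carrier
  powerSum xs u k = sum (map (λ x → u x * d x ^ k) xs)

  damp : Carrier → (X → Carrier) → X → Carrier
  damp a u x = (d x - a) * u x

  -- the identity of powerSum-shift for a single term  u · v^{m+1}  (p = v^m)
  term-shift : ∀ a u v p → u * (v * p) ≈ a * (u * p) + ((v - a) * u) * p
  term-shift a u v p = sym (begin
      a * (u * p) + ((v - a) * u) * p
    ≈⟨ +-congˡ (trans (*-congʳ (distribʳ u v (- a))) (distribʳ p _ _)) ⟩
      a * (u * p) + ((v * u) * p + ((- a) * u) * p)
    ≈⟨ +-congˡ (+-cong (xy∙z≈y∙xz _ _ _) (*-assoc _ _ _)) ⟩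
      a * (u * p) + (u * (v * p) + (- a) * (u * p))
    ≈⟨ x∙yz≈y∙xz _ _ _ ⟩
      u * (v * p) + (a * (u * p) + (- a) * (u * p))
    ≈⟨ +-congˡ (trans (sym (distribʳ _ a (- a)))
                      (trans (*-congʳ (-‿inverseʳ a)) (zeroˡ _))) ⟩
      u * (v * p) + 0#
    ≈⟨ +-identityʳ _ ⟩
      u * (v * p) ∎)
    where
      open CommutativeSemigroupProperties *-commutativeSemigroup using (xy∙z≈y∙xz)
      open CommutativeSemigroupProperties +-commutativeSemigroup using (x∙yz≈y∙xz)

  -- s_{m+1}(u) = a · s_m(u) + s_m((d − a) u): damping lowers the order by one
  powerSum-shift : ∀ a u xs m →
    powerSum xs u (suc m) ≈ a * powerSum xs u m + powerSum xs (damp a u) m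
  powerSum-shift a u []       m = sym (trans (+-identityʳ _) (zeroʳ a))
  powerSum-shift a u (x ∷ xs) m = begin
      u x * (d x * d x ^ m) + powerSum xs u (suc m)
    ≈⟨ +-cong (term-shift a (u x) (d x) (d x ^ m)) (powerSum-shift a u xs m) ⟩
      (a * (u x * d x ^ m) + damp a u x * d x ^ m)
        + (a * powerSum xs u m + powerSum xs (damp a u) m)
    ≈⟨ interchange _ _ _ _ ⟩
      (a * (u x * d x ^ m) + a * powerSum xs u m)
        + (damp a u x * d x ^ m + powerSum xs (damp a u) m)
    ≈⟨ +-congʳ (sym (distribˡ a _ _)) ⟩
      a * powerSum (x ∷ xs) u m + powerSum (x ∷ xs) (damp a u) m ∎
    where open CommutativeSemigroupProperties +-commutativeSemigroup using (interchange)

  damp-removes : ∀ u x xs m →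
    powerSum (x ∷ xs) (damp (d x) u) m ≈ powerSum xs (damp (d x) u) m
  damp-removes u x xs m = trans (+-congʳ (trans (*-congʳ damped-weight) (zeroˡ _))) (+-identityˡ _)
    where
      damped-weight : damp (d x) u x ≈ 0#
      damped-weight = trans (*-congʳ (-‿inverseʳ (d x))) (zeroˡ _)

  null-node : ∀ u x xs m → d x ≈ 0# → powerSum (x ∷ xs) u (suc m) ≈ powerSum xs u (suc m)
  null-node u x xs m dx≈0 = trans (+-congʳ (trans (*-congˡ power≈0) (zeroʳ _))) (+-identityˡ _)
    where
      power≈0 : d x ^ suc m ≈ 0#
      power≈0 = trans (*-congʳ dx≈0) (zeroˡ _)

  vanishing-summand : ∀ {s y z} → s ≈ y + z → s ≈ 0# → y ≈ 0# → z ≈ 0#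
  vanishing-summand {s} {y} {z} s≈y+z s≈0 y≈0 = begin
    z      ≈⟨ sym (+-identityˡ z) ⟩
    0# + z ≈⟨ +-congʳ (sym y≈0) ⟩
    y + z  ≈⟨ sym s≈y+z ⟩
    s      ≈⟨ s≈0 ⟩
    0#     ∎

  cancel-nonzero : ∀ {a s} → ¬ (a ≈ 0#) → a * s ≈ 0# → s ≈ 0#
  cancel-nonzero {a} {s} a≉0 as≈0 = begin
    s             ≈⟨ sym (*-identityˡ s) ⟩
    1# * s        ≈⟨ *-congʳ (sym (trans (*-comm _ _) (proj₂ inv))) ⟩
    (a⁻¹ * a) * s ≈⟨ *-assoc _ _ _ ⟩
    a⁻¹ * (a * s) ≈⟨ *-congˡ as≈0 ⟩
    a⁻¹ * 0#      ≈⟨ zeroʳ _ ⟩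
    0#            ∎
    where
      inv = inverse a a≉0
      a⁻¹ = proj₁ inv

  -- Induction
  -- on the nodes, for all weights u: a null first node is dropped; otherwise damping by
  -- a = d x₀ removes it, keeps the higher power sums zero, and recovers s₁ from a · s₁.
  first-powerSum-vanishes : ∀ xs u →
    (∀ k → powerSum xs u (suc (suc k)) ≈ 0#) → ¬ ¬ (powerSum xs u 1 ≈ 0#)
  first-powerSum-vanishes []        u higher s₁≉0 = s₁≉0 refl
  first-powerSum-vanishes (x₀ ∷ xs) u higher s₁≉0 = ¬¬-excluded-middle λ where
      (yes a≈0) → first-powerSum-vanishes xs u
                    (λ k → trans (sym (null-node u x₀ xs (suc k) a≈0)) (higher k))
                    (s₁≉0 ∘ trans (null-node u x₀ xs 0 a≈0))
      (no a≉0)  → first-powerSum-vanishes xs (damp a u) damped-higher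
                    (s₁≉0 ∘ damped-first a≉0)
    where
      a = d x₀
      damped-higher : ∀ k → powerSum xs (damp a u) (suc (suc k)) ≈ 0#
      damped-higher k = trans (sym (damp-removes u x₀ xs (suc (suc k))))
        (vanishing-summand (powerSum-shift a u (x₀ ∷ xs) (suc (suc k))) (higher (suc k))
                           (trans (*-congˡ (higher k)) (zeroʳ a)))
      damped-first : ¬ (a ≈ 0#) →
                     powerSum xs (damp a u) 1 ≈ 0# → powerSum (x₀ ∷ xs) u 1 ≈ 0#
      damped-first a≉0 t₁≈0 = cancel-nonzero a≉0
        (vanishing-summand (trans (powerSum-shift a u (x₀ ∷ xs) 1) (+-comm _ _)) (higher 0)
                           (trans (damp-removes u x₀ xs 1) t₁≈0))

theorem4p3 : {c ℓ : Level} (F : Field c ℓ) →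
    ¬ (Σ (WeightedGraph F) (λ H → (G : Graph) → Field._≈_ F (pm F G) (hom F G H)))
theorem4p3 F (H , pm≈hom) = first-powerSum-vanishes vertices α higher-vanish first≉0
  where
    open Field F
    open WeightedGraph H using (α)
    open StarHom F H using (vertices; d; hom-Star)
    open PowerSums F d using (powerSum; first-powerSum-vanishes)
    open import Relation.Binary.Reasoning.Setoid setoid

    higher-vanish : ∀ k → powerSum vertices α (suc (suc k)) ≈ 0#
    higher-vanish k = begin
      powerSum vertices α (suc (suc k)) ≈⟨ hom-Star (suc (suc k)) ⟨
      hom F (Star (suc (suc k))) H      ≈⟨ pm≈hom (Star (suc (suc k))) ⟨
      pm F (Star (suc (suc k)))         ≡⟨ ≡.cong (ℕ→F F) (#pm-Star k) ⟩
      0#                                ∎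

    first≉0 : ¬ (powerSum vertices α 1 ≈ 0#)
    first≉0 first≈0 = 0≉1 (sym (begin
      1#                        ≈⟨ +-identityʳ 1# ⟨
      ℕ→F F 1                   ≡⟨ ≡.cong (ℕ→F F) #pm-Star1 ⟨
      pm F (Star 1)             ≈⟨ pm≈hom (Star 1) ⟩
      hom F (Star 1) H          ≈⟨ hom-Star 1 ⟩
      powerSum vertices α 1     ≈⟨ first≈0 ⟩
      0#                        ∎))
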